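{- An element $(S,E)\in\mathcal{SE}_\alpha$ is maximally expanded (admits no formal edge expansion) if and only if all internal vertices of $S$ are trivalent and each interior vertex of $E$ has exactly one outgoing edge.
   Context: $\alpha$ is a finite sequence of labels in $\{\mathrm{in},\mathrm{out}\}$ whose out-labels are at positions $j_1<\dots<j_{k}$, with $n_\alpha$ labels in total. A Stasheff tree is a planar tree with a chosen exterior vertex (root), no bivalent vertices, at least two non-root exterior vertices; its exterior vertices are numbered $1,\dots,n$ clockwise from the root. An essential spine is a planar tree $E$ with a chosen exterior vertex, each edge labelled by one of its two orientations or by $\leftrightarrow$, such that each external edge is labelled with the orientation toward its exterior vertex or with $\leftrightarrow$, and each internal vertex has at least one outgoing edge (an edge labelled with the orientation pointing away from it). $S$ and $E$ are compatible if the underlying planar tree of $E$ equals the subtree of $S$ formed by the union of shortest paths between exterior vertices numbered $j_1,\dots,j_k$. $\mathcal{SE}_\alpha$ is the set of pairs $(S,E)$ with $S$ a Stasheff tree with $n_\alpha$ exterior vertices and $E$ a compatible essential spine (equivalently, pairs $(S_T,E_T)$ for $\alpha$-trees $T$). An edge expansion of a Stasheff tree $S$ by one edge is a Stasheff tree $S'$ with an interior edge whose contraction gives $S$. For $(S,E),(S',E')\in\mathcal{SE}_\alpha$, $(S',E')$ is a formal edge expansion of $(S,E)$ by one edge if either (i) $S'=S$ and $E'$ is obtained from $E$ by changing one edge label from an orientation to $\leftrightarrow$; (ii) $S'$ is a one-edge expansion of $S$, the new edge does not lie in the spine, and $E'=E$; or (iii) $S'$ is a one-edge expansion of $S$, the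 new edge lies in $E'$ and is labelled by an orientation in $E'$. A formal edge expansion is a finite nonempty sequence of these. -}

module Defs where

open import Data.Nat using (ℕ; zero; suc; _+_; _≤_; _<_)
open import Data.List using (List; []; _∷_; _++_; length)
open import Data.Maybe using (Maybe; just; nothing)
open import Data.Product using (Σ; ∃; _×_; _,_)
open import Data.Sum using (_⊎_)
open import Data.Empty using (⊥)
open import Data.Unit using (⊤)
open import Relation.Binary.PropositionalEquality using (_≡_; _≢_)
open import Relation.Binary.Construct.Closure.Transitive using (TransClosure)

data InOut : Set where
  inn out : InOut

countOut : List InOut → ℕ
countOut [] = 0
countOut (inn ∷ xs) = countOut xs
countOut (out ∷ xs) = suc (countOut xs)

-- Edge labels of an essential spine: the two orientations and ↔.
--   toParent : oriented towards the vertex nearer the root of S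
--   toChild  : oriented away from the root of S
--   both     : ↔

data Dir : Set where
  toChild toParent both : Dir

-- A pair (S , E) is encoded as the planar tree S, rooted at its chosen
-- exterior vertex, in which every edge carries a 'Maybe Dir':
--   nothing : the edge is not an edge of the spine E
--   just d  : the edge is an edge of E with label d.
-- A value 't : SETree' is a non-root vertex of S together with the
-- subtree above it; its 'Maybe Dir' is the label of the edge from it
-- to its parent (for the top vertex: the edge to the root exterior
-- vertex).  Children are listed in planar (clockwise) order.
-- Leaves (non-root exterior vertices) record the label of α at their
-- position, which makes the numbering of exterior vertices explicit.

data SETree : Set where
  lf : InOut → Maybe Dir → SETree
  nd : Maybe Dir → List SETree → SETree

label : SETree → Maybe Dir
label (lf _ l) = l
label (nd l _) = l

mutual
  leafSeq : SETree → List InOut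
  leafSeq (lf x _) = x ∷ []
  leafSeq (nd _ cs) = leafSeqs cs

  leafSeqs : List SETree → List InOut
  leafSeqs [] = []
  leafSeqs (c ∷ cs) = leafSeq c ++ leafSeqs cs

outs : SETree → ℕ
outs t = countOut (leafSeq t)

mutual
  Every : (SETree → Set) → SETree → Set
  Every P (lf x l) = P (lf x l)
  Every P (nd l cs) = P (nd l cs) × Everys P cs

  Everys : (SETree → Set) → List SETree → Set
  Everys P [] = ⊤
  Everys P (c ∷ cs) = Every P c × Everys P cs

-- Stasheff shape: the vertex adjacent to the root is internal and no
-- internal vertex is bivalent (it has ≥ 2 children besides its parent).

IsNode : SETree → Set
IsNode (lf _ _) = ⊥
IsNode (nd _ _) = ⊤

Branching : SETree → Set
Branching (lf _ _) = ⊤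
Branching (nd _ cs) = 2 ≤ length cs

Trivalent : SETree → Set
Trivalent (lf _ _) = ⊤
Trivalent (nd _ cs) = length cs ≡ 2

-- With k = total number of out-labels, the edge below t lies on
-- the shortest path between two out-labelled exterior vertices iff one
-- of them lies above the edge and the other one does not.

InSpine : ℕ → SETree → Set
InSpine k t = 1 ≤ outs t × outs t < k

Labelled : SETree → Set
Labelled t = ∃ λ d → label t ≡ just d

LabelOK : ℕ → SETree → Set
LabelOK k t = (Labelled t → InSpine k t) × (InSpine k t → Labelled t)

inE : Maybe Dir → ℕ
inE nothing = 0
inE (just _) = 1

awayUp : Maybe Dir → ℕ
awayUp (just toParent) = 1
awayUp _ = 0

awayDown : Maybe Dir → ℕ
awayDown (just toChild) = 1
awayDown _ = 0

sumL : (SETree → ℕ) → List SETree → ℕ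
sumL f [] = 0
sumL f (c ∷ cs) = f c + sumL f cs

eDeg : SETree → ℕ
eDeg (lf _ l) = inE l
eDeg (nd l cs) = inE l + sumL (λ c → inE (label c)) cs

outDeg : SETree → ℕ
outDeg (lf _ l) = awayUp l
outDeg (nd l cs) = awayUp l + sumL (λ c → awayDown (label c)) cs

rootEDeg : SETree → ℕ
rootEDeg T = inE (label T)

rootOutDeg : SETree → ℕ
rootOutDeg T = awayDown (label T)

-- essential-spine condition at a vertex with E-degree e and o outgoing
-- edges: an exterior vertex of E (degree 1) has its edge labelled towards
-- it or ↔ (i.e. not outgoing); an interior vertex of E (degree ≥ 2) has
-- at least one outgoing edge.
VertexOK : ℕ → ℕ → Set
VertexOK e o = (e ≡ 1 → o ≡ 0) × (2 ≤ e → 1 ≤ o)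

OneOut : ℕ → ℕ → Set
OneOut e o = 2 ≤ e → o ≡ 1

AllVertices : (ℕ → ℕ → Set) → SETree → Set
AllVertices Q T = Q (rootEDeg T) (rootOutDeg T) × Every (λ t → Q (eDeg t) (outDeg t)) T

-- SE_α.  α = r ∷ β : r is the label of the root (exterior vertex 1),
-- β the labels of exterior vertices 2 … n_α in clockwise order.

InSE : List InOut → SETree → Set
InSE [] T = ⊥
InSE (r ∷ β) T =
  IsNode T × Every Branching T × leafSeq T ≡ β
  × Every (LabelOK (countOut (r ∷ β))) T
  × AllVertices VertexOK T

-- Contraction of one interior edge (between two internal vertices),
-- whose label is m.  'ContrT m T' T' : contracting that edge of T' gives T.

mutual
  data ContrT (m : Maybe Dir) : SETree → SETree → Set where
    inside : ∀ {l cs cs'} → ContrL m cs cs' → ContrT m (nd l cs) (nd l cs')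

  data ContrL (m : Maybe Dir) : List SETree → List SETree → Set where
    here : ∀ {ds bs} → ContrL m (nd m ds ∷ bs) (ds ++ bs)
    deep : ∀ {c c' bs} → ContrT m c c' → ContrL m (c ∷ bs) (c' ∷ bs)
    skip : ∀ {b bs bs'} → ContrL m bs bs' → ContrL m (b ∷ bs) (b ∷ bs')

IsOrientation : Dir → Set
IsOrientation d = d ≢ both

mutual
  data RelabT : SETree → SETree → Set where
    atLeaf : ∀ {x d} → IsOrientation d → RelabT (lf x (just d)) (lf x (just both))
    atNode : ∀ {d cs} → IsOrientation d → RelabT (nd (just d) cs) (nd (just both) cs)
    inside : ∀ {l cs cs'} → RelabL cs cs' → RelabT (nd l cs) (nd l cs')

  data RelabL : List SETree → List SETree → Set where
    deep : ∀ {c c' bs} → RelabT c c' → RelabL (c ∷ bs) (c' ∷ bs)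
    skip : ∀ {b bs bs'} → RelabL bs bs' → RelabL (b ∷ bs) (b ∷ bs')

-- One-step formal edge expansion (S,E) ↦ (S',E') within SE_α:
--  (i)   RelabT;
--  (ii)  one-edge expansion whose new edge is not in the spine (label
--        nothing), all other labels unchanged (E' = E);
--  (iii) one-edge expansion whose new edge is in E' with an orientation
--        label, all other labels unchanged.
FormalStep : List InOut → SETree → SETree → Set
FormalStep α T T' =
  InSE α T × InSE α T'
  × (RelabT T T' ⊎ Σ (Maybe Dir) (λ m → m ≢ just both × ContrT m T' T))

FormalExpansion : List InOut → SETree → SETree → Set
FormalExpansion α = TransClosure (FormalStep α)

MaximallyExpanded : List InOut → SETree → Set
MaximallyExpanded α T = Σ SETree (λ T' → FormalExpansion α T T') → ⊥

-- Both conditions are local. Contracting an edge merges the children of its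
-- lower endpoint into those of its upper endpoint, which then has at least three;
-- relabelling an oriented edge to ↔ costs one endpoint an outgoing edge, which an
-- exterior vertex of E never had and an interior vertex with exactly one cannot
-- spare. Conversely, at a vertex with three or more children the first two can
-- be moved below a new vertex, the new edge lying in the spine exactly when they
-- carry some but not all out-labels and being oriented so that both of its
-- endpoints keep an outgoing edge; and at a vertex with two outgoing edges one of
-- them points to a child and can be relabelled ↔.
module Submission where

open import Defs
open import Data.List using (List)
open import Data.Product using (_×_)
open import Function.Bundles using (_⇔_)

open import Data.Empty using (⊥-elim)
open import Data.List using ([]; _∷_; _++_; length)
open import Data.List.Properties using (++-assoc; ++-identityʳ; length-++)
open import Data.List.Relation.Binary.Pointwise as Pointwise using (Pointwise; []; _∷_; Pointwise-length)
open import Data.Maybe using (Maybe; just; nothing)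
open import Data.Nat using (ℕ; zero; suc; _+_; _≤_; _<_; z≤n; s≤s; s≤s⁻¹; _≤?_; _<?_)
open import Data.Nat.Properties
open import Data.Product using (Σ; ∃; _,_; proj₁; proj₂)
open import Data.Sum using (_⊎_; inj₁; inj₂)
open import Data.Unit using (tt)
open import Function.Bundles using (mk⇔)
open import Relation.Binary.Construct.Closure.Transitive using (TransClosure; [_]; _∷_)
open import Relation.Binary.PropositionalEquality
open import Relation.Nullary using (¬_; yes; no)

mutual
  Every-map : ∀ {P Q : SETree → Set} → (∀ {t} → P t → Q t) → ∀ t → Every P t → Every Q t
  Every-map f (lf x l) p = f p
  Every-map f (nd l cs) (p , ps) = f p , Everys-map f cs ps

  Everys-map : ∀ {P Q : SETree → Set} → (∀ {t} → P t → Q t) → ∀ cs → Everys P cs → Everys Q cs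
  Everys-map f [] _ = tt
  Everys-map f (c ∷ cs) (p , ps) = Every-map f c p , Everys-map f cs ps

mutual
  Every-zip : ∀ {P Q : SETree → Set} t → Every P t → Every Q t → Every (λ u → P u × Q u) t
  Every-zip (lf x l) p q = p , q
  Every-zip (nd l cs) (p , ps) (q , qs) = (p , q) , Everys-zip cs ps qs

  Everys-zip : ∀ {P Q : SETree → Set} cs → Everys P cs → Everys Q cs → Everys (λ u → P u × Q u) cs
  Everys-zip [] _ _ = tt
  Everys-zip (c ∷ cs) (p , ps) (q , qs) = Every-zip c p q , Everys-zip cs ps qs

Every-top : ∀ {P : SETree → Set} t → Every P t → P t
Every-top (lf x l) p = p
Every-top (nd l cs) (p , _) = p

first-step : ∀ {A : Set} {R : A → A → Set} {x y} → TransClosure R x y → ∃ (R x)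
first-step [ r ] = _ , r
first-step (r ∷ _) = _ , r

countOut-++ : ∀ xs ys → countOut (xs ++ ys) ≡ countOut xs + countOut ys
countOut-++ [] ys = refl
countOut-++ (inn ∷ xs) ys = countOut-++ xs ys
countOut-++ (out ∷ xs) ys = cong suc (countOut-++ xs ys)

outsL : List SETree → ℕ
outsL cs = countOut (leafSeqs cs)

outsL-∷ : ∀ c cs → outsL (c ∷ cs) ≡ outs c + outsL cs
outsL-∷ c cs = countOut-++ (leafSeq c) (leafSeqs cs)

childEDeg childOutDeg : List SETree → ℕ
childEDeg = sumL (λ c → inE (label c))
childOutDeg = sumL (λ c → awayDown (label c))

awayDown≤inE : ∀ m → awayDown m ≤ inE m
awayDown≤inE nothing = z≤n
awayDown≤inE (just toChild) = s≤s z≤n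
awayDown≤inE (just toParent) = z≤n
awayDown≤inE (just both) = z≤n

awayUp≤1 : ∀ m → awayUp m ≤ 1
awayUp≤1 nothing = z≤n
awayUp≤1 (just toChild) = z≤n
awayUp≤1 (just toParent) = s≤s z≤n
awayUp≤1 (just both) = z≤n

childOutDeg≤childEDeg : ∀ cs → childOutDeg cs ≤ childEDeg cs
childOutDeg≤childEDeg [] = z≤n
childOutDeg≤childEDeg (c ∷ cs) = +-mono-≤ (awayDown≤inE (label c)) (childOutDeg≤childEDeg cs)

AtVertex : (ℕ → ℕ → Set) → SETree → Set
AtVertex Q t = Q (eDeg t) (outDeg t)

VertexOK-isolated : ∀ o → VertexOK 0 o
VertexOK-isolated o = (λ ()) , (λ ())

VertexOK-interior : ∀ {e o} → 2 ≤ e → 1 ≤ o → VertexOK e o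
VertexOK-interior {suc zero} (s≤s ()) _
VertexOK-interior {suc (suc e)} _ o≥1 = (λ ()) , (λ _ → o≥1)

¬VertexOK-1-1 : ¬ VertexOK 1 1
¬VertexOK-1-1 (ok , _) with ok refl
... | ()

OneOut-inE : ∀ m o → OneOut (inE m) o
OneOut-inE nothing o ()
OneOut-inE (just d) o (s≤s ())

OneOut⊎twoOut : ∀ {e o} → VertexOK e o → OneOut e o ⊎ (2 ≤ e × 2 ≤ o)
OneOut⊎twoOut {e} {o} ok with 2 ≤? e | o ≟ 1
... | no e<2 | _ = inj₁ (λ e≥2 → ⊥-elim (e<2 e≥2))
... | yes _ | yes o≡1 = inj₁ (λ _ → o≡1)
... | yes e≥2 | no o≢1 = inj₂ (e≥2 , ≤∧≢⇒< (proj₂ ok e≥2) (λ 1≡o → o≢1 (sym 1≡o)))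

OneOut-tight : ∀ {e o o'} → 1 ≤ e → o ≡ suc o' → VertexOK e o → OneOut e o → ¬ VertexOK e o'
OneOut-tight {suc zero} _ refl (exterior , _) _ _ with exterior refl
... | ()
OneOut-tight {suc (suc e)} _ refl _ one (_ , interior) with one (s≤s (s≤s z≤n))
... | refl with interior (s≤s (s≤s z≤n))
... | ()

mutual
  trivalent-not-contracted : ∀ {m t' t} → ContrT m t' t → Every Branching t' → ¬ Every Trivalent t
  trivalent-not-contracted (inside p) (branching , bs) (trivalent , ts) =
    <⇒≱ (subst (_ <_) trivalent (contraction-lengthens p bs ts)) branching

  contraction-lengthens : ∀ {m cs' cs} → ContrL m cs' cs → Everys Branching cs' → Everys Trivalent cs →
    length cs' < length cs
  contraction-lengthens (here {ds} {bs}) ((branching , _) , _) _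
    rewrite length-++ ds {bs} = +-monoˡ-≤ (length bs) branching
  contraction-lengthens (deep p) (b , _) (t , _) = ⊥-elim (trivalent-not-contracted p b t)
  contraction-lengthens (skip p) (_ , bs) (_ , ts) = s≤s (contraction-lengthens p bs ts)

mutual
  relabel-at-top : ∀ {t t'} → RelabT t t' →
    Every (AtVertex VertexOK) t → Every (AtVertex OneOut) t → Every (AtVertex VertexOK) t' →
    label t ≡ just toChild × label t' ≡ just both
  relabel-at-top (atLeaf {d = toChild} _) _ _ _ = refl , refl
  relabel-at-top (atLeaf {d = toParent} _) ok _ _ = ⊥-elim (¬VertexOK-1-1 ok)
  relabel-at-top (atLeaf {d = both} notBoth) _ _ _ = ⊥-elim (notBoth refl)
  relabel-at-top (atNode {d = toChild} _) _ _ _ = refl , refl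
  relabel-at-top (atNode {d = toParent} _) (ok , _) (one , _) (ok' , _) =
    ⊥-elim (OneOut-tight (s≤s z≤n) refl ok one ok')
  relabel-at-top (atNode {d = both} notBoth) _ _ _ = ⊥-elim (notBoth refl)
  relabel-at-top (inside {l} {cs} {cs'} p) (ok , oks) (one , ones) (ok' , oks')
    with relabel-in-children p oks ones oks'
  ... | out-drop , e-same =
    ⊥-elim (OneOut-tight e≥1 (trans (cong (awayUp l +_) out-drop) (+-suc (awayUp l) (childOutDeg cs')))
              ok one (subst (λ e → VertexOK e (awayUp l + childOutDeg cs')) (cong (inE l +_) (sym e-same)) ok'))
    where
    e≥1 : 1 ≤ inE l + childEDeg cs
    e≥1 = ≤-trans (subst (1 ≤_) (sym out-drop) (s≤s z≤n))
            (≤-trans (childOutDeg≤childEDeg cs) (m≤n+m _ (inE l)))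

  relabel-in-children : ∀ {cs cs'} → RelabL cs cs' →
    Everys (AtVertex VertexOK) cs → Everys (AtVertex OneOut) cs → Everys (AtVertex VertexOK) cs' →
    childOutDeg cs ≡ suc (childOutDeg cs') × childEDeg cs ≡ childEDeg cs'
  relabel-in-children (deep p) (ok , _) (one , _) (ok' , _) with relabel-at-top p ok one ok'
  ... | before , after rewrite before | after = refl , refl
  relabel-in-children {b ∷ _} (skip p) (_ , oks) (_ , ones) (_ , oks')
    with relabel-in-children p oks ones oks'
  ... | out-drop , e-same =
    trans (cong (awayDown (label b) +_) out-drop) (+-suc (awayDown (label b)) _) ,
    cong (inE (label b) +_) e-same

Between : ℕ → ℕ → Set
Between k o = 1 ≤ o × o < k

IsLabelled : Maybe Dir → Set
IsLabelled m = ∃ λ d → m ≡ just d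

-- LabelOK k t unfolds to LabelFor k (outs t) (label t).
LabelFor : ℕ → ℕ → Maybe Dir → Set
LabelFor k o m = (IsLabelled m → Between k o) × (Between k o → IsLabelled m)

module _ {k : ℕ} where

  LabelFor-oriented : ∀ {o} d → Between k o → LabelFor k o (just d)
  LabelFor-oriented d between = (λ _ → between) , (λ _ → d , refl)

  LabelFor-unlabelled : ∀ {o} → ¬ Between k o → LabelFor k o nothing
  LabelFor-unlabelled outside = (λ ()) , (λ between → ⊥-elim (outside between))

  LabelFor-relabel : ∀ {o d} d' → LabelFor k o (just d) → LabelFor k o (just d')
  LabelFor-relabel {d = d} d' fits = LabelFor-oriented d' (proj₁ fits (d , refl))

  LabelFor-outside : ∀ {o m} → LabelFor k o m → ¬ Between k o → m ≡ nothing
  LabelFor-outside {m = nothing} _ _ = refl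
  LabelFor-outside {m = just d} fits outside = ⊥-elim (outside (proj₁ fits (d , refl)))

  inE-between : ∀ {o m} → LabelFor k o m → Between k o → 1 ≤ inE m
  inE-between fits between with proj₂ fits between
  ... | _ , refl = s≤s z≤n

  inE≤outs : ∀ {o m} → LabelFor k o m → inE m ≤ o
  inE≤outs {m = nothing} _ = z≤n
  inE≤outs {m = just d} fits = proj₁ (proj₁ fits (d , refl))

-- A vertex with top edge l, first two child edges m₁ m₂ and further children
-- contributing eR edges of E and aR outgoing ones, receives a new vertex below
-- it, joined by the edge new, to which the first two children are moved.
record Grouping (k o : ℕ) (l m₁ m₂ : Maybe Dir) (eR aR : ℕ) : Set where
  field
    new : Maybe Dir
    new-≢both : new ≢ just both
    new-fits : LabelFor k o new
    lower-ok : VertexOK (inE new + (inE m₁ + (inE m₂ + 0))) (awayUp new + (awayDown m₁ + (awayDown m₂ + 0)))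
    upper-ok : VertexOK (inE l + (inE new + eR)) (awayUp l + (awayDown new + aR))

1≤+0 : ∀ a b → 1 ≤ a + b → 1 ≤ a + (b + 0)
1≤+0 a b = subst (λ x → 1 ≤ a + x) (sym (+-identityʳ b))

2≤+suc : ∀ a b → 1 ≤ a + b → 2 ≤ a + suc b
2≤+suc a b h = subst (2 ≤_) (sym (+-suc a b)) (s≤s h)

module _ {k : ℕ} where

  group-unlabelled-pair : ∀ {o l m₁ m₂} eR aR → m₁ ≡ nothing → m₂ ≡ nothing → ¬ Between k o →
    VertexOK (inE l + (inE m₁ + (inE m₂ + eR))) (awayUp l + (awayDown m₁ + (awayDown m₂ + aR))) →
    Grouping k o l m₁ m₂ eR aR
  group-unlabelled-pair eR aR refl refl outside ok = record
    { new = nothing ; new-≢both = λ () ; new-fits = LabelFor-unlabelled outside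
    ; lower-ok = VertexOK-isolated 0 ; upper-ok = ok }

  group-unlabelled-rest : ∀ {o l m₁ m₂ eR aR} → l ≡ nothing → eR ≡ 0 → aR ≡ 0 → ¬ Between k o →
    VertexOK (inE l + (inE m₁ + (inE m₂ + eR))) (awayUp l + (awayDown m₁ + (awayDown m₂ + aR))) →
    Grouping k o l m₁ m₂ eR aR
  group-unlabelled-rest refl refl refl outside ok = record
    { new = nothing ; new-≢both = λ () ; new-fits = LabelFor-unlabelled outside
    ; lower-ok = ok ; upper-ok = VertexOK-isolated 0 }

  -- The new edge points down if the pair had an outgoing edge, and up otherwise,
  -- so that neither of its endpoints is left without one.
  group-on-spine : ∀ {o} l m₁ m₂ eR aR → Between k o → 1 ≤ inE m₁ + inE m₂ → 1 ≤ inE l + eR →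
    VertexOK (inE l + (inE m₁ + (inE m₂ + eR))) (awayUp l + (awayDown m₁ + (awayDown m₂ + aR))) →
    Grouping k o l m₁ m₂ eR aR
  group-on-spine l m₁ m₂ eR aR between pair≥1 rest≥1 ok with 1 ≤? awayDown m₁ + awayDown m₂
  ... | yes pairOut = record
    { new = just toChild ; new-≢both = λ () ; new-fits = LabelFor-oriented toChild between
    ; lower-ok = VertexOK-interior (s≤s (1≤+0 (inE m₁) (inE m₂) pair≥1))
                                   (1≤+0 (awayDown m₁) (awayDown m₂) pairOut)
    ; upper-ok = VertexOK-interior (2≤+suc (inE l) eR rest≥1)
                                   (≤-trans (s≤s z≤n) (m≤n+m (suc aR) (awayUp l))) }
  ... | no noPairOut = record
    { new = just toParent ; new-≢both = λ () ; new-fits = LabelFor-oriented toParent between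
    ; lower-ok = VertexOK-interior (s≤s (1≤+0 (inE m₁) (inE m₂) pair≥1)) (s≤s z≤n)
    ; upper-ok = VertexOK-interior (2≤+suc (inE l) eR rest≥1)
                                   (subst (λ a → 1 ≤ awayUp l + a) away-rest (proj₂ ok old≥2)) }
    where
    old≥2 : 2 ≤ inE l + (inE m₁ + (inE m₂ + eR))
    old≥2 = ≤-trans (2≤+suc (inE l) eR rest≥1) (+-monoʳ-≤ (inE l)
              (≤-trans (+-monoˡ-≤ eR pair≥1) (≤-reflexive (+-assoc (inE m₁) (inE m₂) eR))))
    away-rest : awayDown m₁ + (awayDown m₂ + aR) ≡ aR
    away-rest = begin
      awayDown m₁ + (awayDown m₂ + aR) ≡⟨ sym (+-assoc (awayDown m₁) (awayDown m₂) aR) ⟩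
      awayDown m₁ + awayDown m₂ + aR   ≡⟨ cong (_+ aR) (n≤0⇒n≡0 (≮⇒≥ noPairOut)) ⟩
      aR                               ∎
      where open ≡-Reasoning

  touches-spine-+ : ∀ {o₁ o₂ m e} → LabelFor k o₁ m → (Between k o₂ → 1 ≤ e) →
    Between k (o₁ + o₂) → 1 ≤ inE m + e
  touches-spine-+ {zero} {m = m} _ spine₂ between = ≤-trans (spine₂ between) (m≤n+m _ (inE m))
  touches-spine-+ {suc o₁} {o₂} {e = e} fits₁ _ (_ , o<k) =
    ≤-trans (inE-between fits₁ (s≤s z≤n , ≤-<-trans (m≤m+n (suc o₁) o₂) o<k)) (m≤m+n _ e)

  -- The out-labels not below the pair lie either outside the vertex (then l is
  -- on the spine) or below one of the other children.
  rest-touches-spine : ∀ {o oR l eR} → LabelFor k (o + oR) l → o + oR ≤ k →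
    (Between k oR → 1 ≤ eR) → Between k o → 1 ≤ inE l + eR
  rest-touches-spine {o} {oR} {l} {eR} fits bound restSpine (o≥1 , o<k) with o + oR <? k
  ... | yes total<k = ≤-trans (inE-between fits (≤-trans o≥1 (m≤m+n o oR) , total<k)) (m≤m+n (inE l) eR)
  ... | no total≮k with oR
  ...   | zero = ⊥-elim (total≮k (subst (_< k) (sym (+-identityʳ o)) o<k))
  ...   | suc oR' =
    ≤-trans (restSpine (s≤s z≤n , ≤-trans (+-monoˡ-≤ (suc oR') o≥1) bound)) (m≤n+m eR (inE l))

  grouping : ∀ o₁ o₂ oR l m₁ m₂ eR aR → o₁ + o₂ + oR ≤ k →
    LabelFor k (o₁ + o₂ + oR) l → LabelFor k o₁ m₁ → LabelFor k o₂ m₂ →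
    eR ≤ oR → aR ≤ eR → (Between k oR → 1 ≤ eR) →
    VertexOK (inE l + (inE m₁ + (inE m₂ + eR))) (awayUp l + (awayDown m₁ + (awayDown m₂ + aR))) →
    Grouping k (o₁ + o₂) l m₁ m₂ eR aR
  grouping o₁ o₂ oR l m₁ m₂ eR aR bound fits fits₁ fits₂ eR≤oR aR≤eR restSpine ok
    with 1 ≤? o₁ + o₂ | o₁ + o₂ <? k
  ... | yes o≥1 | yes o<k =
    group-on-spine l m₁ m₂ eR aR (o≥1 , o<k) (touches-spine-+ fits₁ (inE-between fits₂) (o≥1 , o<k))
      (rest-touches-spine fits bound restSpine (o≥1 , o<k)) ok
  ... | no o≱1 | _ =
    group-unlabelled-pair eR aR (LabelFor-outside fits₁ (λ (b , _) → o≱1 (≤-trans b (m≤m+n o₁ o₂))))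
      (LabelFor-outside fits₂ (λ (b , _) → o≱1 (≤-trans b (m≤n+m o₂ o₁)))) (λ (b , _) → o≱1 b) ok
  ... | yes _ | no o≮k = group-unlabelled-rest l≡nothing eR≡0 aR≡0 (λ (_ , o<k) → o≮k o<k) ok
    where
    k≤o : k ≤ o₁ + o₂
    k≤o = ≮⇒≥ o≮k
    l≡nothing : l ≡ nothing
    l≡nothing = LabelFor-outside fits (λ (_ , total<k) → <⇒≱ total<k (≤-trans k≤o (m≤m+n _ oR)))
    oR≡0 : oR ≡ 0
    oR≡0 = n≤0⇒n≡0 (+-cancelˡ-≤ (o₁ + o₂) oR 0
             (≤-trans bound (≤-trans k≤o (≤-reflexive (sym (+-identityʳ (o₁ + o₂)))))))
    eR≡0 : eR ≡ 0
    eR≡0 = n≤0⇒n≡0 (subst (eR ≤_) oR≡0 eR≤oR)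
    aR≡0 : aR ≡ 0
    aR≡0 = n≤0⇒n≡0 (subst (aR ≤_) eR≡0 aR≤eR)

Valid : ℕ → SETree → Set
Valid k t = Branching t × LabelOK k t × AtVertex VertexOK t

Step : SETree → SETree → Set
Step t t' = RelabT t t' ⊎ Σ (Maybe Dir) (λ m → m ≢ just both × ContrT m t' t)

StepL : List SETree → List SETree → Set
StepL cs cs' = RelabL cs cs' ⊎ Σ (Maybe Dir) (λ m → m ≢ just both × ContrL m cs' cs)

Step-inside : ∀ {l cs cs'} → StepL cs cs' → Step (nd l cs) (nd l cs')
Step-inside (inj₁ r) = inj₁ (inside r)
Step-inside (inj₂ (m , m≢both , c)) = inj₂ (m , m≢both , inside c)

StepL-head : ∀ {c c' cs} → Step c c' → StepL (c ∷ cs) (c' ∷ cs)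
StepL-head (inj₁ r) = inj₁ (deep r)
StepL-head (inj₂ (m , m≢both , c)) = inj₂ (m , m≢both , deep c)

StepL-tail : ∀ {c cs cs'} → StepL cs cs' → StepL (c ∷ cs) (c ∷ cs')
StepL-tail (inj₁ r) = inj₁ (skip r)
StepL-tail (inj₂ (m , m≢both , c)) = inj₂ (m , m≢both , skip c)

Step-IsNode : ∀ {t t'} → Step t t' → IsNode t → IsNode t'
Step-IsNode (inj₁ (atLeaf _)) ()
Step-IsNode (inj₁ (atNode _)) _ = tt
Step-IsNode (inj₁ (inside _)) _ = tt
Step-IsNode (inj₂ (_ , _ , inside _)) _ = tt

SameLeavesAndSpineEdge : SETree → SETree → Set
SameLeavesAndSpineEdge c c' = leafSeq c' ≡ leafSeq c × inE (label c') ≡ inE (label c)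

leafSeqs-pointwise : ∀ {cs cs'} → Pointwise SameLeavesAndSpineEdge cs cs' → leafSeqs cs' ≡ leafSeqs cs
leafSeqs-pointwise [] = refl
leafSeqs-pointwise ((same , _) ∷ sims) = cong₂ _++_ same (leafSeqs-pointwise sims)

childEDeg-pointwise : ∀ {cs cs'} → Pointwise SameLeavesAndSpineEdge cs cs' → childEDeg cs' ≡ childEDeg cs
childEDeg-pointwise [] = refl
childEDeg-pointwise ((_ , same) ∷ sims) = cong₂ _+_ same (childEDeg-pointwise sims)

demote : SETree → SETree
demote (lf x _) = lf x (just both)
demote (nd _ cs) = nd (just both) cs

label-demote : ∀ t → label (demote t) ≡ just both
label-demote (lf _ _) = refl
label-demote (nd _ _) = refl

leafSeq-demote : ∀ t → leafSeq (demote t) ≡ leafSeq t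
leafSeq-demote (lf _ _) = refl
leafSeq-demote (nd _ _) = refl

toChild⊎notAway : ∀ m → m ≡ just toChild ⊎ awayDown m ≡ 0
toChild⊎notAway nothing = inj₂ refl
toChild⊎notAway (just toChild) = inj₁ refl
toChild⊎notAway (just toParent) = inj₂ refl
toChild⊎notAway (just both) = inj₂ refl

outs≤outsL-∷ : ∀ c cs → outs c ≤ outsL (c ∷ cs)
outs≤outsL-∷ c cs = ≤-trans (m≤m+n (outs c) (outsL cs)) (≤-reflexive (sym (outsL-∷ c cs)))

outsL≤outsL-∷ : ∀ c cs → outsL cs ≤ outsL (c ∷ cs)
outsL≤outsL-∷ c cs = ≤-trans (m≤n+m (outsL cs) (outs c)) (≤-reflexive (sym (outsL-∷ c cs)))

outs-pair : ∀ m c₁ c₂ → outs (nd m (c₁ ∷ c₂ ∷ [])) ≡ outs c₁ + outs c₂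
outs-pair m c₁ c₂ =
  trans (outsL-∷ c₁ (c₂ ∷ [])) (cong (outs c₁ +_) (trans (outsL-∷ c₂ []) (+-identityʳ (outs c₂))))

outsL-split : ∀ c₁ c₂ cs → outsL (c₁ ∷ c₂ ∷ cs) ≡ outs c₁ + outs c₂ + outsL cs
outsL-split c₁ c₂ cs = begin
  outsL (c₁ ∷ c₂ ∷ cs)            ≡⟨ outsL-∷ c₁ (c₂ ∷ cs) ⟩
  outs c₁ + outsL (c₂ ∷ cs)        ≡⟨ cong (outs c₁ +_) (outsL-∷ c₂ cs) ⟩
  outs c₁ + (outs c₂ + outsL cs)   ≡⟨ sym (+-assoc (outs c₁) (outs c₂) (outsL cs)) ⟩
  outs c₁ + outs c₂ + outsL cs     ∎
  where open ≡-Reasoning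

leafSeqs-regroup : ∀ m c₁ c₂ cs → leafSeqs (nd m (c₁ ∷ c₂ ∷ []) ∷ cs) ≡ leafSeqs (c₁ ∷ c₂ ∷ cs)
leafSeqs-regroup m c₁ c₂ cs = begin
  (leafSeq c₁ ++ (leafSeq c₂ ++ [])) ++ leafSeqs cs
    ≡⟨ ++-assoc (leafSeq c₁) (leafSeq c₂ ++ []) (leafSeqs cs) ⟩
  leafSeq c₁ ++ ((leafSeq c₂ ++ []) ++ leafSeqs cs)
    ≡⟨ cong (λ s → leafSeq c₁ ++ (s ++ leafSeqs cs)) (++-identityʳ (leafSeq c₂)) ⟩
  leafSeq c₁ ++ (leafSeq c₂ ++ leafSeqs cs)
    ∎
  where open ≡-Reasoning

countOut-≤-∷ : ∀ r β → countOut β ≤ countOut (r ∷ β)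
countOut-≤-∷ inn β = ≤-refl
countOut-≤-∷ out β = n≤1+n (countOut β)

module Expansions (k : ℕ) where

  record Expansion (t : SETree) : Set where
    field
      expanded : SETree
      valid : Every (Valid k) expanded
      label-≡ : label expanded ≡ label t
      leafSeq-≡ : leafSeq expanded ≡ leafSeq t
      step : Step t expanded

  record ExpansionL (cs : List SETree) : Set where
    field
      expanded : List SETree
      valid : Everys (Valid k) expanded
      similar : Pointwise SameLeavesAndSpineEdge cs expanded
      childOutDeg-≡ : childOutDeg expanded ≡ childOutDeg cs
      step : StepL cs expanded

  record Demotion (cs : List SETree) : Set where
    field
      demoted : List SETree
      valid : Everys (Valid k) demoted
      similar : Pointwise SameLeavesAndSpineEdge cs demoted
      childOutDeg-drop : childOutDeg cs ≡ suc (childOutDeg demoted)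
      relabel : RelabL cs demoted

  Valid-children : ∀ {l cs cs'} → Pointwise SameLeavesAndSpineEdge cs cs' → Valid k (nd l cs) →
    VertexOK (inE l + childEDeg cs') (awayUp l + childOutDeg cs') → Valid k (nd l cs')
  Valid-children {l} sims (branching , fits , _) ok =
    subst (2 ≤_) (Pointwise-length sims) branching ,
    subst (λ s → LabelFor k (countOut s) l) (sym (leafSeqs-pointwise sims)) fits ,
    ok

  childEDeg≤outsL : ∀ cs → Everys (Valid k) cs → childEDeg cs ≤ outsL cs
  childEDeg≤outsL [] _ = z≤n
  childEDeg≤outsL (c ∷ cs) (v , vs) =
    ≤-trans (+-mono-≤ (inE≤outs (proj₁ (proj₂ (Every-top c v)))) (childEDeg≤outsL cs vs))
            (≤-reflexive (sym (outsL-∷ c cs)))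

  children-touch-spine : ∀ cs → Everys (Valid k) cs → Between k (outsL cs) → 1 ≤ childEDeg cs
  children-touch-spine [] _ (() , _)
  children-touch-spine (c ∷ cs) (v , vs) between =
    touches-spine-+ (proj₁ (proj₂ (Every-top c v))) (children-touch-spine cs vs)
      (subst (Between k) (outsL-∷ c cs) between)

  expand-inside : ∀ {l cs} → Valid k (nd l cs) → ExpansionL cs → Expansion (nd l cs)
  expand-inside {l} (branching , fits , ok) e = record
    { expanded = nd l expanded
    ; valid = Valid-children similar (branching , fits , ok)
        (subst₂ (λ d o → VertexOK (inE l + d) (awayUp l + o))
           (sym (childEDeg-pointwise similar)) (sym childOutDeg-≡) ok) , valid
    ; label-≡ = refl
    ; leafSeq-≡ = leafSeqs-pointwise similar
    ; step = Step-inside step }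
    where open ExpansionL e

  expand-head : ∀ {c cs} → Expansion c → Everys (Valid k) cs → ExpansionL (c ∷ cs)
  expand-head {c} {cs} e valids = record
    { expanded = expanded ∷ cs
    ; valid = valid , valids
    ; similar = (leafSeq-≡ , cong inE label-≡) ∷ Pointwise.refl (refl , refl)
    ; childOutDeg-≡ = cong (λ m → awayDown m + childOutDeg cs) label-≡
    ; step = StepL-head step }
    where open Expansion e

  expand-tail : ∀ {c cs} → Every (Valid k) c → ExpansionL cs → ExpansionL (c ∷ cs)
  expand-tail {c} v e = record
    { expanded = c ∷ expanded
    ; valid = v , valid
    ; similar = (refl , refl) ∷ similar
    ; childOutDeg-≡ = cong (awayDown (label c) +_) childOutDeg-≡
    ; step = StepL-tail step }
    where open ExpansionL e

  demote-toChild : ∀ c → label c ≡ just toChild → Every (Valid k) c →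
    RelabT c (demote c) × Every (Valid k) (demote c)
  demote-toChild (lf x _) refl (branching , fits , ok) =
    atLeaf (λ ()) , (branching , LabelFor-relabel both fits , ok)
  demote-toChild (nd _ cs) refl ((branching , fits , ok) , vs) =
    atNode (λ ()) , ((branching , LabelFor-relabel both fits , ok) , vs)

  demote-child : ∀ cs → Everys (Valid k) cs → 1 ≤ childOutDeg cs → Demotion cs
  demote-child [] _ ()
  demote-child (c ∷ cs) (v , vs) out≥1 with toChild⊎notAway (label c)
  ... | inj₁ isToChild = record
    { demoted = demote c ∷ cs
    ; valid = proj₂ (demote-toChild c isToChild v) , vs
    ; similar = (leafSeq-demote c , trans (cong inE (label-demote c)) (cong inE (sym isToChild)))
                ∷ Pointwise.refl (refl , refl)
    ; childOutDeg-drop = trans (cong (λ m → awayDown m + childOutDeg cs) isToChild)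
                               (cong (λ m → suc (awayDown m + childOutDeg cs)) (sym (label-demote c)))
    ; relabel = deep (proj₁ (demote-toChild c isToChild v)) }
  ... | inj₂ notAway = record
    { demoted = c ∷ demoted
    ; valid = v , valid
    ; similar = (refl , refl) ∷ similar
    ; childOutDeg-drop = trans (cong (awayDown (label c) +_) childOutDeg-drop) (+-suc _ _)
    ; relabel = skip relabel }
    where open Demotion (demote-child cs vs (subst (λ a → 1 ≤ a + childOutDeg cs) notAway out≥1))

  demote-surplus : ∀ {l cs} → Valid k (nd l cs) → Everys (Valid k) cs →
    2 ≤ inE l + childEDeg cs → 2 ≤ awayUp l + childOutDeg cs → Expansion (nd l cs)
  demote-surplus {l} {cs} valid valids e≥2 o≥2 = record
    { expanded = nd l demoted
    ; valid = Valid-children similar valid (VertexOK-interior e'≥2 o'≥1) , Demotion.valid d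
    ; label-≡ = refl
    ; leafSeq-≡ = leafSeqs-pointwise similar
    ; step = inj₁ (inside relabel) }
    where
    d : Demotion cs
    d = demote-child cs valids (s≤s⁻¹ (≤-trans o≥2 (+-monoˡ-≤ (childOutDeg cs) (awayUp≤1 l))))
    open Demotion d hiding (valid)
    e'≥2 : 2 ≤ inE l + childEDeg demoted
    e'≥2 = subst (λ e → 2 ≤ inE l + e) (sym (childEDeg-pointwise similar)) e≥2
    o'≥1 : 1 ≤ awayUp l + childOutDeg demoted
    o'≥1 = s≤s⁻¹ (subst (2 ≤_) (trans (cong (awayUp l +_) childOutDeg-drop) (+-suc (awayUp l) _)) o≥2)

  group-first-two : ∀ l c₁ c₂ c₃ cs → outsL (c₁ ∷ c₂ ∷ c₃ ∷ cs) ≤ k →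
    Valid k (nd l (c₁ ∷ c₂ ∷ c₃ ∷ cs)) → Everys (Valid k) (c₁ ∷ c₂ ∷ c₃ ∷ cs) →
    Expansion (nd l (c₁ ∷ c₂ ∷ c₃ ∷ cs))
  group-first-two l c₁ c₂ c₃ cs bound (_ , fits , ok) (v₁ , v₂ , vs) = record
    { expanded = nd l (nd new (c₁ ∷ c₂ ∷ []) ∷ rest)
    ; valid = (s≤s (s≤s z≤n) , subst (λ s → LabelFor k (countOut s) l) (sym regroup) fits , upper-ok) ,
              ((s≤s (s≤s z≤n) , subst (λ o → LabelFor k o new) (sym (outs-pair new c₁ c₂)) new-fits ,
                lower-ok) , v₁ , v₂ , tt) ,
              vs
    ; label-≡ = refl
    ; leafSeq-≡ = regroup
    ; step = inj₂ (new , new-≢both , inside here) }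
    where
    rest : List SETree
    rest = c₃ ∷ cs
    split : outsL (c₁ ∷ c₂ ∷ rest) ≡ outs c₁ + outs c₂ + outsL rest
    split = outsL-split c₁ c₂ rest
    fits-of : ∀ c → Every (Valid k) c → LabelFor k (outs c) (label c)
    fits-of c v = proj₁ (proj₂ (Every-top c v))
    open Grouping (grouping (outs c₁) (outs c₂) (outsL rest) l (label c₁) (label c₂)
      (childEDeg rest) (childOutDeg rest) (subst (_≤ k) split bound) (subst (λ o → LabelFor k o l) split fits)
      (fits-of c₁ v₁) (fits-of c₂ v₂) (childEDeg≤outsL rest vs) (childOutDeg≤childEDeg rest)
      (children-touch-spine rest vs) ok)
    regroup : leafSeqs (nd new (c₁ ∷ c₂ ∷ []) ∷ rest) ≡ leafSeqs (c₁ ∷ c₂ ∷ rest)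
    regroup = leafSeqs-regroup new c₁ c₂ rest

  expand-vertex : ∀ l cs → outsL cs ≤ k → Valid k (nd l cs) → Everys (Valid k) cs →
    Everys Trivalent cs → Everys (AtVertex OneOut) cs →
    (Every Trivalent (nd l cs) × Every (AtVertex OneOut) (nd l cs)) ⊎ Expansion (nd l cs)
  expand-vertex l [] _ (() , _) _ _ _
  expand-vertex l (_ ∷ []) _ (s≤s () , _) _ _ _
  expand-vertex l (_ ∷ _ ∷ []) _ valid valids trivalent oneOut with OneOut⊎twoOut (proj₂ (proj₂ valid))
  ... | inj₁ oneOutHere = inj₁ ((refl , trivalent) , (oneOutHere , oneOut))
  ... | inj₂ (e≥2 , o≥2) = inj₂ (demote-surplus valid valids e≥2 o≥2)
  expand-vertex l (c₁ ∷ c₂ ∷ c₃ ∷ cs) bound valid valids _ _ =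
    inj₂ (group-first-two l c₁ c₂ c₃ cs bound valid valids)

  mutual
    search : ∀ t → outs t ≤ k → Every (Valid k) t →
      (Every Trivalent t × Every (AtVertex OneOut) t) ⊎ Expansion t
    search (lf x l) _ _ = inj₁ (tt , OneOut-inE l (awayUp l))
    search (nd l cs) bound (valid , valids) with searchL cs bound valids
    ... | inj₁ (trivalent , oneOut) = expand-vertex l cs bound valid valids trivalent oneOut
    ... | inj₂ e = inj₂ (expand-inside valid e)

    searchL : ∀ cs → outsL cs ≤ k → Everys (Valid k) cs →
      (Everys Trivalent cs × Everys (AtVertex OneOut) cs) ⊎ ExpansionL cs
    searchL [] _ _ = inj₁ (tt , tt)
    searchL (c ∷ cs) bound (v , vs) with search c (≤-trans (outs≤outsL-∷ c cs) bound) v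
    ... | inj₂ e = inj₂ (expand-head e vs)
    ... | inj₁ (trivalent , oneOut) with searchL cs (≤-trans (outsL≤outsL-∷ c cs) bound) vs
    ...   | inj₁ (trivalents , oneOuts) = inj₁ ((trivalent , trivalents) , (oneOut , oneOuts))
    ...   | inj₂ e = inj₂ (expand-tail v e)

module _ {r : InOut} {β : List InOut} where
  open Expansions (countOut (r ∷ β))

  InSE-expansion : ∀ {T} → InSE (r ∷ β) T → (e : Expansion T) → InSE (r ∷ β) (Expansion.expanded e)
  InSE-expansion (isNode , _ , leaves , _ , rootOK , _) e =
    Step-IsNode step isNode ,
    Every-map proj₁ expanded valid ,
    trans leafSeq-≡ leaves ,
    Every-map (λ v → proj₁ (proj₂ v)) expanded valid ,
    subst (λ m → VertexOK (inE m) (awayDown m)) (sym label-≡) rootOK ,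
    Every-map (λ v → proj₂ (proj₂ v)) expanded valid
    where open Expansion e

lemma2p8 : (α : List InOut) (T : SETree) → InSE α T →
    MaximallyExpanded α T ⇔ (Every Trivalent T × AllVertices OneOut T)
lemma2p8 [] T ()
lemma2p8 α@(r ∷ β) T inSE@(_ , branching , leaves , labels , rootOK , vertexOK) = mk⇔ shape maximal
  where
  open Expansions (countOut α)

  shape : MaximallyExpanded α T → Every Trivalent T × AllVertices OneOut T
  shape noExpansion with search T (subst (λ s → countOut s ≤ countOut α) (sym leaves) (countOut-≤-∷ r β))
                                  (Every-zip T branching (Every-zip T labels vertexOK))
  ... | inj₁ (trivalent , oneOut) = trivalent , OneOut-inE (label T) _ , oneOut
  ... | inj₂ e = ⊥-elim (noExpansion (expanded , [ inSE , InSE-expansion {r} {β} inSE e , step ]))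
    where open Expansion e

  maximal : Every Trivalent T × AllVertices OneOut T → MaximallyExpanded α T
  maximal (trivalent , _ , oneOut) (_ , expansion) with first-step expansion
  ... | _ , _ , (_ , _ , _ , _ , _ , vertexOK') , inj₁ relabel =
    ¬VertexOK-1-1 (subst (λ m → VertexOK (inE m) (awayDown m))
                     (proj₁ (relabel-at-top relabel vertexOK oneOut vertexOK')) rootOK)
  ... | _ , _ , (_ , branching' , _) , inj₂ (_ , _ , contraction) =
    trivalent-not-contracted contraction branching' trivalent
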